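{- Let $G$ be a graph, $\mathcal{M}$ a spherical map for $G$, and $x:\mathsf{N}_G$. Then for every loop edge $e:\mathsf{E}_{U(G)}(x,x)$ we have $\|(e\odot\langle x\rangle)\sim_{\mathcal{M}}\langle x\rangle\|$.
   Context: Setting: homotopy type theory with propositional truncation $\|\cdot\|$. A graph $G$: a set $\mathsf{N}_G$ of nodes and sets $\mathsf{E}_G(x,y)$ of edges. Its symmetrisation $U(G)$ has nodes $\mathsf{N}_G$ and edges $\mathsf{E}_{U(G)}(x,y):\equiv\mathsf{E}_G(x,y)+\mathsf{E}_G(y,x)$. Walks: inductive family $\mathsf{W}(x,y)$ with $\langle x\rangle:\mathsf{W}(x,x)$ and $e\odot w:\mathsf{W}(x,z)$ for an edge $e$ from $x$ to $y$ and $w:\mathsf{W}(y,z)$; $\cdot$ concatenation. $u\in\langle z\rangle:\equiv\mathbb{0}$, $u\in(e\odot w):\equiv(u=\mathsf{source}(e))+(u\in w)$; $\mathsf{isQuasi}(w):\equiv\prod_u\mathsf{isProp}(u\in w)$. A map for $G$ is a rotation system $\mathcal{M}:\prod_{x:\mathsf{N}_G}\mathsf{Cyclic}(\sum_y\mathsf{E}_{U(G)}(x,y))$, with $\mathsf{Cyclic}(A):\equiv\sum_{\varphi:A\to A}\sum_{n:\mathbb{N}}\|\sum_{e:A\simeq⟦n⟧}(e\circ\varphi=\mathsf{pred}\circ e)\|$ ($\mathsf{pred}$ the cyclic predecessor on the $n$-element type $⟦n⟧$). $\mathcal{M}$ determines faces: each face $\mathcal{F}$ is a cyclic subgraph $A$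 of $U(G)$ with a function $f$ from nodes of $A$ to $\mathsf{N}_G$, giving for nodes $a,b$ of $A$ walks $\mathsf{cw}_{\mathcal{F}}(a,b),\mathsf{ccw}_{\mathcal{F}}(a,b)$ in $U(G)$ from $f(a)$ to $f(b)$. Walk homotopy $\sim_{\mathcal{M}}$ on $\mathsf{W}_{U(G)}(x,y)$ is the inductive family generated by reflexivity, symmetry, transitivity, and $(w_1\cdot\mathsf{ccw}_{\mathcal{F}}(a,b)\cdot w_2)\sim_{\mathcal{M}}(w_1\cdot\mathsf{cw}_{\mathcal{F}}(a,b)\cdot w_2)$ for any face $\mathcal{F}$, nodes $a,b$ of it and walks $w_1:\mathsf{W}_{U(G)}(x,f(a))$, $w_2:\mathsf{W}_{U(G)}(f(b),y)$. $\mathcal{M}$ is spherical if $\|w_1\sim_{\mathcal{M}}w_2\|$ for all $x,y$ and all quasi-simple $w_1,w_2:\mathsf{W}_{U(G)}(x,y)$. -}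

module Defs where

open import Level using (Level; 0ℓ) renaming (suc to lsuc)
open import Data.Nat using (ℕ; zero; suc; _+_; _∸_; _≤_; _<_; NonZero)
open import Data.Nat.Properties using (+-suc; m+[n∸m]≡n; ≤-trans; m≤m+n; m≤n+m; <⇒≤)
open import Data.Nat.DivMod using (_%_; _mod_; m%n%n≡m%n; %-distribˡ-+; [m+n]%n≡m%n; m<n⇒m%n≡m)
open import Data.Fin using (Fin; toℕ)
open import Data.Fin.Properties using (toℕ-injective; toℕ<n)
open import Data.Fin.Base using (fromℕ; inject₁)
open import Data.Empty using (⊥)
open import Data.Sum using (_⊎_; inj₁; inj₂)
open import Data.Product using (Σ; _,_; proj₁; proj₂; Σ-syntax)
open import Function.Bundles using (_↔_; Inverse)
open import Relation.Binary.PropositionalEquality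
  using (_≡_; refl; sym; trans; cong; subst; module ≡-Reasoning)

isProp : Set → Set
isProp A = (a b : A) → a ≡ b

isSet : Set → Set
isSet A = (a b : A) → isProp (a ≡ b)

-- Propositional truncation, impredicative (Church) encoding:
-- the universal property of ∥ A ∥ w.r.t. propositions in Set.
∥_∥ : Set → Set₁
∥ A ∥ = (P : Set) → isProp P → (A → P) → P

∣_∣ : {A : Set} → A → ∥ A ∥
∣ a ∣ P _ f = f a

pred : {n : ℕ} → Fin n → Fin n
pred {suc m} Fin.zero    = fromℕ m
pred {suc m} (Fin.suc i) = inject₁ i

-- Cyclic(A) = Σ (φ : A → A) Σ (n : ℕ) ∥ Σ (e : A ≃ ⟦n⟧) (e ∘ φ = pred ∘ e) ∥
-- (function equality rendered pointwise)
Cyclic : Set → Set₁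
Cyclic A = Σ[ φ ∈ (A → A) ] Σ[ n ∈ ℕ ]
  ∥ Σ[ e ∈ A ↔ Fin n ] ((a : A) → Inverse.to e (φ a) ≡ pred (Inverse.to e a)) ∥

record Graph : Set₁ where
  field
    Node      : Set
    Edge      : Node → Node → Set
    Node-set  : isSet Node
    Edge-set  : (x y : Node) → isSet (Edge x y)
open Graph public

EU : (G : Graph) → Node G → Node G → Set
EU G x y = Edge G x y ⊎ Edge G y x

revE : {G : Graph} {x y : Node G} → EU G x y → EU G y x
revE (inj₁ e) = inj₂ e
revE (inj₂ e) = inj₁ e

data W {N : Set} (E : N → N → Set) : N → N → Set where
  ⟨_⟩ : (x : N) → W E x x
  _⊙_ : {x y z : N} → E x y → W E y z → W E x z

infixr 5 _⊙_ _·_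

_·_ : {N : Set} {E : N → N → Set} {x y z : N} → W E x y → W E y z → W E x z
⟨ _ ⟩   · v = v
(e ⊙ w) · v = e ⊙ (w · v)

_∈W_ : {N : Set} {E : N → N → Set} {x y : N} → N → W E x y → Set
u ∈W ⟨ z ⟩            = ⊥
u ∈W (_⊙_ {x = s} e w) = (u ≡ s) ⊎ (u ∈W w)

isQuasi : {N : Set} {E : N → N → Set} {x y : N} → W E x y → Set
isQuasi {N} w = (u : N) → isProp (u ∈W w)

castW : {N : Set} {E : N → N → Set} {x x' y y' : N} →
        x ≡ x' → y ≡ y' → W E x y → W E x' y'
castW refl refl w = w

revW : {G : Graph} {x y : Node G} → W (EU G) x y → W (EU G) y x
revW ⟨ x ⟩   = ⟨ x ⟩
revW {G} (_⊙_ {x = x} e w) = revW {G} w · (revE {G} e ⊙ ⟨ x ⟩)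

Dart : (G : Graph) → Node G → Set
Dart G x = Σ[ y ∈ Node G ] EU G x y

Map : Graph → Set₁
Map G = (x : Node G) → Cyclic (Dart G x)

rot : {G : Graph} → Map G → (x : Node G) → Dart G x → Dart G x
rot M x = proj₁ (M x)

pos : {m : ℕ} → ℕ → Fin (suc m)
pos {m} j = j mod suc m

succF : {m : ℕ} → Fin (suc m) → Fin (suc m)
succF i = pos (suc (toℕ i))

-- j ⊕ k = j + k, computed so that j ⊕ suc k = suc j ⊕ k
_⊕_ : ℕ → ℕ → ℕ
j ⊕ zero  = j
j ⊕ suc k = suc j ⊕ k

⊕≡+ : (j k : ℕ) → j ⊕ k ≡ j + k
⊕≡+ j zero    = sym (Data.Nat.Properties.+-identityʳ j)
⊕≡+ j (suc k) = trans (⊕≡+ (suc j) k) (sym (+-suc j k))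

%-absorb : (c x d : ℕ) .{{_ : NonZero d}} → (c + x % d) % d ≡ (c + x) % d
%-absorb c x d = begin
    (c + x % d) % d             ≡⟨ %-distribˡ-+ c (x % d) d ⟩
    (c % d + x % d % d) % d     ≡⟨ cong (λ t → (c % d + t) % d) (m%n%n≡m%n x d) ⟩
    (c % d + x % d) % d         ≡⟨ sym (%-distribˡ-+ c x d) ⟩
    (c + x) % d                 ∎
  where open ≡-Reasoning

%-step : (c d n : ℕ) .{{_ : NonZero n}} → c ≤ n → (c + (d + n ∸ c) % n) % n ≡ d % n
%-step c d n c≤n = begin
    (c + (d + n ∸ c) % n) % n   ≡⟨ %-absorb c (d + n ∸ c) n ⟩
    (c + (d + n ∸ c)) % n       ≡⟨ cong (_% n) (m+[n∸m]≡n (≤-trans c≤n (m≤n+m n d))) ⟩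
    (d + n) % n                 ≡⟨ [m+n]%n≡m%n d n ⟩
    d % n                       ∎
  where open ≡-Reasoning

toℕ-pos : (m j : ℕ) → toℕ (pos {m} j) ≡ j % suc m
toℕ-pos m j = Data.Fin.Properties.toℕ-fromℕ< (Data.Nat.DivMod.m%n<n j (suc m))

pos-toℕ : {m : ℕ} (a : Fin (suc m)) → pos (toℕ a) ≡ a
pos-toℕ {m} a = toℕ-injective (trans (toℕ-pos m (toℕ a)) (m<n⇒m%n≡m (toℕ<n a)))

succF-pos : {m : ℕ} (j : ℕ) → succF (pos {m} j) ≡ pos (suc j)
succF-pos {m} j = toℕ-injective (begin
    toℕ (pos {m} (suc (toℕ (pos {m} j))))  ≡⟨ toℕ-pos m (suc (toℕ (pos {m} j))) ⟩
    suc (toℕ (pos {m} j)) % suc m       ≡⟨ cong (λ t → suc t % suc m) (toℕ-pos m j) ⟩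
    (1 + j % suc m) % suc m             ≡⟨ %-absorb 1 j (suc m) ⟩
    suc j % suc m                       ≡⟨ sym (toℕ-pos m (suc j)) ⟩
    toℕ (pos {m} (suc j))               ∎)
  where open ≡-Reasoning

-- A face is a cyclic graph on ⟦ n ⟧ = Fin (suc m) (edges i → succ i),
-- with a node map f into N_G and edge map into U(G), such that the
-- boundary is traced by the rotation system: arriving at f(i+1) along
-- edge i, the next edge (i+1) is the rotation successor of the
-- reversed incoming dart.

record Face (G : Graph) (M : Map G) : Set where
  field
    m     : ℕ
    node  : Fin (suc m) → Node G
    edge  : (i : Fin (suc m)) → EU G (node i) (node (succF i))
    turn  : (i : Fin (suc m)) →
            rot {G} M (node (succF i)) (node i , revE {G} (edge i))
              ≡ (node (succF (succF i)) , edge (succF i))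

module _ {G : Graph} {M : Map G} (F : Face G M) where
  open Face F

  private
    n : ℕ
    n = suc m

    edgeAt : (j : ℕ) → EU G (node (pos j)) (node (pos (suc j)))
    edgeAt j = subst (λ t → EU G (node (pos j)) (node t)) (succF-pos j) (edge (pos j))

    fwd : (j k : ℕ) → W (EU G) (node (pos j)) (node (pos (j ⊕ k)))
    fwd j zero    = ⟨ _ ⟩
    fwd j (suc k) = edgeAt j ⊙ fwd (suc j) k

    end-cw : (a b : Fin n) → pos (toℕ a ⊕ ((toℕ b + n ∸ toℕ a) % n)) ≡ b
    end-cw a b = toℕ-injective (begin
        toℕ (pos {m} (toℕ a ⊕ k))   ≡⟨ toℕ-pos m (toℕ a ⊕ k) ⟩
        (toℕ a ⊕ k) % n         ≡⟨ cong (_% n) (⊕≡+ (toℕ a) k) ⟩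
        (toℕ a + k) % n         ≡⟨ %-step (toℕ a) (toℕ b) n (<⇒≤ (toℕ<n a)) ⟩
        toℕ b % n               ≡⟨ m<n⇒m%n≡m (toℕ<n b) ⟩
        toℕ b                   ∎)
      where open ≡-Reasoning
            k = (toℕ b + n ∸ toℕ a) % n

    end-ccw : (a b : Fin n) → pos (toℕ b ⊕ suc ((toℕ a + n ∸ suc (toℕ b)) % n)) ≡ a
    end-ccw a b = toℕ-injective (begin
        toℕ (pos {m} (toℕ b ⊕ suc k))   ≡⟨ toℕ-pos m (toℕ b ⊕ suc k) ⟩
        (toℕ b ⊕ suc k) % n         ≡⟨ cong (_% n) (⊕≡+ (suc (toℕ b)) k) ⟩
        (suc (toℕ b) + k) % n       ≡⟨ %-step (suc (toℕ b)) (toℕ a) n (toℕ<n b) ⟩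
        toℕ a % n                   ≡⟨ m<n⇒m%n≡m (toℕ<n a) ⟩
        toℕ a                       ∎)
      where open ≡-Reasoning
            k = (toℕ a + n ∸ suc (toℕ b)) % n

  -- cw(a,b): from a to b following the face direction ((b-a) mod n steps;
  -- the trivial walk when a = b)
  cw : (a b : Fin (suc m)) → W (EU G) (node a) (node b)
  cw a b = castW (cong node (pos-toℕ {m} a)) (cong node (end-cw a b))
                 (fwd (toℕ a) ((toℕ b + suc m ∸ toℕ a) % suc m))

  -- ccw(a,b): from a to b against the face direction: the reversal of the
  -- clockwise walk from b to a of length in [1, n] (the whole boundary
  -- when a = b), so cw(a,b) and ccw(a,b) are the two ways around the face
  ccw : (a b : Fin (suc m)) → W (EU G) (node a) (node b)
  ccw a b = revW {G} (castW (cong node (pos-toℕ {m} b)) (cong node (end-ccw a b))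
                 (fwd (toℕ b) (suc ((toℕ a + suc m ∸ suc (toℕ b)) % suc m))))

data Homotopic (G : Graph) (M : Map G) : {x y : Node G} → W (EU G) x y → W (EU G) x y → Set where
  ∼-refl  : {x y : Node G} (w : W (EU G) x y) → Homotopic G M w w
  ∼-sym   : {x y : Node G} {w v : W (EU G) x y} → Homotopic G M w v → Homotopic G M v w
  ∼-trans : {x y : Node G} {u v w : W (EU G) x y} →
            Homotopic G M u v → Homotopic G M v w → Homotopic G M u w
  ∼-face  : {x y : Node G} (F : Face G M) (a b : Fin (suc (Face.m F)))
            (w₁ : W (EU G) x (Face.node F a)) (w₂ : W (EU G) (Face.node F b) y) →
            Homotopic G M (w₁ · ccw F a b · w₂) (w₁ · cw F a b · w₂)

isSpherical : (G : Graph) → Map G → Set₁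
isSpherical G M = (x y : Node G) (w₁ w₂ : W (EU G) x y) →
  isQuasi w₁ → isQuasi w₂ → ∥ Homotopic G M w₁ w₂ ∥

{-# OPTIONS --safe #-}
module Submission where

open import Defs
open import Data.Sum using (inj₁; inj₂)
open import Relation.Binary.PropositionalEquality using (cong)

isQuasi-⟨⟩ : {N : Set} {E : N → N → Set} (x : N) → isQuasi {E = E} ⟨ x ⟩
isQuasi-⟨⟩ x u ()

isQuasi-single : {N : Set} (E : N → N → Set) → isSet N →
                 {x y : N} (e : E x y) → isQuasi {E = E} (e ⊙ ⟨ y ⟩)
isQuasi-single E N-set {x} e u (inj₁ p) (inj₁ q) = cong inj₁ (N-set u x p q)
isQuasi-single E N-set e u (inj₁ _) (inj₂ ())
isQuasi-single E N-set e u (inj₂ ()) _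

lemma5p6 : (G : Graph) (M : Map G) → isSpherical G M →
           (x : Node G) (e : EU G x x) →
           ∥ Homotopic G M (e ⊙ ⟨ x ⟩) ⟨ x ⟩ ∥
lemma5p6 G M spherical x e =
  spherical x x (e ⊙ ⟨ x ⟩) ⟨ x ⟩ (isQuasi-single (EU G) (Node-set G) e) (isQuasi-⟨⟩ {E = EU G} x)
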